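{- Let $2 \leq p_1 \leq \cdots \leq p_m$ be integers and let $H = K_{p_1} \cup \cdots \cup K_{p_m}$ be the disjoint union of cliques of these orders. Then $H$ is strongly sat-sharp. In particular, there are constants $c_H, c'_H$ depending only on $H$ such that for all $n \geq \sum_{i=1}^m p_i$, \[ (p_1-2)n - c'_H \leq \operatorname{sat}(H,n) \leq (p_1-2)n + c_H. \]
   Context: All graphs are finite and simple. A graph $G$ is $H$-free if it has no subgraph isomorphic to $H$, and $H$-saturated if it is $H$-free and for every non-edge $xy$ of $G$ the graph $G+xy$ contains a subgraph isomorphic to $H$. For $n \geq |V(H)|$, $\operatorname{sat}(H,n)$ is the minimum number of edges of an $H$-saturated graph on $n$ vertices. For an edge $uv$ of $H$, labelled so that $d(u)\leq d(v)$, $\operatorname{wt}(uv) = 2|N(u)\cap N(v)| + |N(v)-N(u)|$ (open neighborhoods in $H$), and $\operatorname{wt}(H)$ is the minimum edge weight. $H$ is strongly sat-sharp if $\operatorname{sat}(H,n) = \frac{\operatorname{wt}(H)-1}{2}n + O(1)$ as $n\to\infty$. -}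

module Defs where

open import Data.Nat using (ℕ; zero; suc; _+_; _*_; _∸_; _≤_; _<ᵇ_; _≤ᵇ_; _≡ᵇ_)
open import Data.Bool using (Bool; true; false; _∧_; _∨_; not; if_then_else_)
open import Data.Empty using (⊥-elim)
open import Data.Fin using (Fin; toℕ; splitAt; _≟_)
open import Data.List using (List; []; _∷_; map; allFin)
open import Data.Nat.ListAction using (sum)
open import Data.Sum using (_⊎_; inj₁; inj₂)
open import Data.Product using (Σ; ∃; _×_; _,_)
open import Relation.Nullary using (¬_; does; yes; no)
open import Relation.Binary.PropositionalEquality using (_≡_; _≢_; refl) renaming (sym to ≡-sym)
open import Function.Definitions using (Injective)

record Graph (n : ℕ) : Set where
  field
    adj    : Fin n → Fin n → Bool
    sym    : ∀ i j → adj i j ≡ adj j i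
    irrefl : ∀ i → adj i i ≡ false
open Graph public

count : (n : ℕ) → (Fin n → Bool) → ℕ
count n P = sum (map (λ v → if P v then 1 else 0) (allFin n))

numEdges : ∀ {n} → Graph n → ℕ
numEdges {n} G = sum (map (λ i → count n (λ j → (toℕ i <ᵇ toℕ j) ∧ adj G i j)) (allFin n))

-- G contains a subgraph isomorphic to H: an injective homomorphism H → G
Contains : ∀ {h n} → Graph h → Graph n → Set
Contains {h} {n} H G =
  Σ (Fin h → Fin n) λ f → Injective _≡_ _≡_ f × (∀ a b → adj H a b ≡ true → adj G (f a) (f b) ≡ true)

HFree : ∀ {h n} → Graph h → Graph n → Set
HFree H G = ¬ Contains H G

eqᵇ : ∀ {n} → Fin n → Fin n → Bool
eqᵇ a b = does (a ≟ b)

addEdge : ∀ {n} (G : Graph n) (x y : Fin n) → x ≢ y → Graph n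
addEdge {n} G x y x≢y = record { adj = A ; sym = s ; irrefl = r }
  where
  A : Fin n → Fin n → Bool
  A a b = adj G a b ∨ ((eqᵇ a x ∧ eqᵇ b y) ∨ (eqᵇ a y ∧ eqᵇ b x))
  s : ∀ a b → A a b ≡ A b a
  s a b rewrite Graph.sym G a b with a ≟ x | b ≟ y | a ≟ y | b ≟ x
  ... | yes _ | yes _ | yes _ | yes _ = refl
  ... | yes _ | yes _ | yes _ | no _ = refl
  ... | yes _ | yes _ | no _ | yes _ = refl
  ... | yes _ | yes _ | no _ | no _ = refl
  ... | yes _ | no _ | yes _ | yes _ = refl
  ... | yes _ | no _ | yes _ | no _ = refl
  ... | yes _ | no _ | no _ | yes _ = refl
  ... | yes _ | no _ | no _ | no _ = refl
  ... | no _ | yes _ | yes _ | yes _ = refl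
  ... | no _ | yes _ | yes _ | no _ = refl
  ... | no _ | yes _ | no _ | yes _ = refl
  ... | no _ | yes _ | no _ | no _ = refl
  ... | no _ | no _ | yes _ | yes _ = refl
  ... | no _ | no _ | yes _ | no _ = refl
  ... | no _ | no _ | no _ | yes _ = refl
  ... | no _ | no _ | no _ | no _ = refl
  r : ∀ a → A a a ≡ false
  r a rewrite Graph.irrefl G a with a ≟ x | a ≟ y
  ... | yes refl | yes refl = ⊥-elim (x≢y refl)
  ... | yes _ | no _ = refl
  ... | no _ | yes _ = refl
  ... | no _ | no _ = refl

Saturated : ∀ {h n} → Graph h → Graph n → Set
Saturated {h} {n} H G =
  HFree H G × (∀ (x y : Fin n) (x≢y : x ≢ y) → adj G x y ≡ false → Contains H (addEdge G x y x≢y))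

deg : ∀ {h} → Graph h → Fin h → ℕ
deg {h} H u = count h (adj H u)

wtOriented : ∀ {h} → Graph h → Fin h → Fin h → ℕ
wtOriented {h} H u v =
  2 * count h (λ w → adj H u w ∧ adj H v w) + count h (λ w → adj H v w ∧ not (adj H u w))

edgeWt : ∀ {h} → Graph h → Fin h → Fin h → ℕ
edgeWt H u v = if deg H u ≤ᵇ deg H v then wtOriented H u v else wtOriented H v u

IsWt : ∀ {h} → Graph h → ℕ → Set
IsWt {h} H w =
  (Σ (Fin h) λ u → Σ (Fin h) λ v → adj H u v ≡ true × edgeWt H u v ≡ w)
  × (∀ u v → adj H u v ≡ true → w ≤ edgeWt H u v)

-- strongly sat-sharp: sat(H,n) = ((wt(H) − 1)/2) n + O(1); stated with sat doubled
-- to avoid halves, and sat(H,n) unfolded as the minimum edge number of an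
-- H-saturated graph on n vertices.
StronglySatSharp : ∀ {h} → Graph h → Set
StronglySatSharp {h} H =
  Σ ℕ λ w → IsWt H w × Σ ℕ λ C → Σ ℕ λ N₀ → ∀ n → N₀ ≤ n →
    (Σ (Graph n) λ G → Saturated H G × 2 * numEdges G ≤ (w ∸ 1) * n + C)
    × (∀ (G : Graph n) → Saturated H G → (w ∸ 1) * n ≤ 2 * numEdges G + C)

≡ᵇ-sym : ∀ m n → (m ≡ᵇ n) ≡ (n ≡ᵇ m)
≡ᵇ-sym zero zero = refl
≡ᵇ-sym zero (suc n) = refl
≡ᵇ-sym (suc m) zero = refl
≡ᵇ-sym (suc m) (suc n) = ≡ᵇ-sym m n

-- Disjoint union of cliques K_{p₁} ∪ ... ∪ K_{pₘ} on Fin (p₁ + ... + pₘ):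
-- comp gives the index of the clique containing a vertex.
comp : (ps : List ℕ) → Fin (sum ps) → ℕ
comp [] ()
comp (p ∷ qs) i with splitAt p i
... | inj₁ _ = 0
... | inj₂ j = suc (comp qs j)

cliqueUnion : (ps : List ℕ) → Graph (sum ps)
cliqueUnion ps = record { adj = A ; sym = s ; irrefl = r }
  where
  A : Fin (sum ps) → Fin (sum ps) → Bool
  A a b = not (eqᵇ a b) ∧ (comp ps a ≡ᵇ comp ps b)
  s : ∀ a b → A a b ≡ A b a
  s a b rewrite ≡ᵇ-sym (comp ps a) (comp ps b) with a ≟ b | b ≟ a
  ... | yes _ | yes _ = refl
  ... | yes e | no ne = ⊥-elim (ne (≡-sym e))
  ... | no ne | yes e = ⊥-elim (ne (≡-sym e))
  ... | no _ | no _ = refl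
  r : ∀ a → A a a ≡ false
  r a with a ≟ a
  ... | yes _ = refl
  ... | no ne = ⊥-elim (ne refl)

module Submission where

-- If G is H-saturated and xy is a non-edge, a copy of H in G + xy uses xy as an edge of some
-- clique K_p of H, and the other p − 2 ≥ p₁ − 2 vertices of that clique are common neighbours
-- of x and y in G. A graph in which every non-adjacent pair has t common neighbours has at
-- least tn − 2t² edges: either all degrees are at least 2t, or some vertex x has degree below
-- 2t and each of its non-neighbours sends t edges into N(x). Conversely, for c = p₁ − 2 and
-- M = p₂ + ⋯ + pₘ, the graph on n vertices in which c vertices are universal and c + M + 1
-- vertices span a clique has at most cn + O(1) edges and is H-saturated: every vertex of H
-- has degree above c, so a copy of H would have to fit into the clique of size |H| − 1. An
-- edge of H inside K_p has weight 2(p − 2) + 1, so wt(H) − 1 = 2(p₁ − 2) and both bounds read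
-- (wt(H) − 1)n/2 + O(1).

open import Defs
open import Data.Bool using (Bool; true; false; _∧_; _∨_; not; if_then_else_; T)
open import Data.Bool.Properties using (∧-zeroʳ; ∧-identityʳ; ∧-comm; ∨-zeroʳ; ∨-identityʳ; ∨-comm)
open import Data.Fin using (Fin; zero; suc; toℕ; fromℕ<; _≟_; splitAt; join; _↑ˡ_; _↑ʳ_)
open import Data.Fin.Properties
  using (toℕ-injective; toℕ<n; toℕ-fromℕ<; any?; splitAt-↑ˡ; splitAt-↑ʳ; splitAt⁻¹-↑ˡ; join-splitAt)
  renaming (suc-injective to Fin-suc-injective)
open import Data.List using (List; _∷_; map; tabulate)
open import Data.List.Relation.Unary.All using (All; _∷_)
open import Data.List.Relation.Unary.Linked using (Linked)
open import Data.List.Relation.Unary.Linked.Properties using (Linked⇒All)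
open import Data.Nat
  using (ℕ; zero; suc; _+_; _*_; _∸_; _≤_; _<_; z≤n; s≤s; s≤s⁻¹; _<ᵇ_; _≤ᵇ_; _≡ᵇ_; _<?_; _≤?_)
  renaming (_≟_ to _≟ℕ_)
open import Data.Nat.ListAction using (sum)
open import Data.Nat.Properties hiding (_≟_)
open import Algebra.Properties.Semiring.Sum +-*-semiring
  using (sum-syntax; sum-cong-≗; ∑-distrib-+; ∑-comm; *-distribˡ-sum; *-distribʳ-sum)
  renaming (sum to ∑)
open import Data.Product using (Σ; _×_; _,_)
open import Data.Sum using (_⊎_; inj₁; inj₂)
open import Data.Unit using (tt)
open import Function.Base using (_∘_)
open import Function.Bundles using (mk⇔)
open import Function.Definitions using (Injective)
open import Relation.Binary.Definitions using (tri<; tri≈; tri>)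
open import Relation.Binary.PropositionalEquality
  using (_≡_; _≢_; refl; trans; cong; cong₂; subst; subst₂; module ≡-Reasoning)
  renaming (sym to ≡-sym)
open import Relation.Nullary using (yes; no)
open import Relation.Nullary.Decidable using (dec-true; dec-false; does-⇔)
open import Relation.Nullary.Negation using (contradiction)

-- Counting over Fin n

indicator : Bool → ℕ
indicator b = if b then 1 else 0

indicator-∧ : ∀ x y → indicator (x ∧ y) ≤ indicator y
indicator-∧ true  y = ≤-refl
indicator-∧ false y = z≤n

indicator-∧-* : ∀ x y → indicator (x ∧ y) ≡ indicator x * indicator y
indicator-∧-* true  y = ≡-sym (+-identityʳ (indicator y))
indicator-∧-* false y = refl

indicator≤1 : ∀ x → indicator x ≤ 1
indicator≤1 true  = ≤-refl
indicator≤1 false = z≤n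

indicator-disjoint : ∀ {s t} s′ t′ a → (s ∧ t) ≡ false →
  indicator (s ∧ (t′ ∧ a)) + indicator (s′ ∧ (t ∧ a)) ≤ indicator a
indicator-disjoint {false} {t} s′ t′ a _ = ≤-trans (indicator-∧ s′ (t ∧ a)) (indicator-∧ t a)
indicator-disjoint {true} {false} s′ t′ a _ rewrite ∧-zeroʳ s′ | +-identityʳ (indicator (t′ ∧ a)) =
  indicator-∧ t′ a

∣_∣ : ∀ {n} → (Fin n → Bool) → ℕ
∣_∣ {n} P = ∑[ i < n ] indicator (P i)

sum-map-tabulate : ∀ {A : Set} n (g : A → ℕ) (f : Fin n → A) →
  sum (map g (tabulate f)) ≡ ∑[ i < n ] g (f i)
sum-map-tabulate zero    g f = refl
sum-map-tabulate (suc n) g f = cong (g (f zero) +_) (sum-map-tabulate n g (f ∘ suc))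

count≡∣∣ : ∀ n (P : Fin n → Bool) → count n P ≡ ∣ P ∣
count≡∣∣ n P = sum-map-tabulate n (indicator ∘ P) (λ i → i)

∑-↑ : ∀ m k (f : Fin (m + k) → ℕ) →
  ∑[ i < m + k ] f i ≡ ∑[ i < m ] f (i ↑ˡ k) + ∑[ j < k ] f (m ↑ʳ j)
∑-↑ zero    k f = refl
∑-↑ (suc m) k f = trans (cong (f zero +_) (∑-↑ m k (f ∘ suc))) (≡-sym (+-assoc (f zero) _ _))

∑-mono-≤ : ∀ {n} {f g : Fin n → ℕ} → (∀ i → f i ≤ g i) → ∑[ i < n ] f i ≤ ∑[ i < n ] g i
∑-mono-≤ {zero}  f≤g = z≤n
∑-mono-≤ {suc n} f≤g = +-mono-≤ (f≤g zero) (∑-mono-≤ (f≤g ∘ suc))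

∑-const : ∀ n c → ∑[ i < n ] c ≡ n * c
∑-const zero    c = refl
∑-const (suc n) c = cong (c +_) (∑-const n c)

∑-*ˡ : ∀ {n} c (f : Fin n → ℕ) → ∑[ i < n ] (c * f i) ≡ c * ∑[ i < n ] f i
∑-*ˡ c f = ≡-sym (*-distribˡ-sum c f)

term≤∑ : ∀ {n} (f : Fin n → ℕ) i → f i ≤ ∑[ j < n ] f j
term≤∑ f zero    = m≤m+n _ _
term≤∑ f (suc i) = ≤-trans (term≤∑ (f ∘ suc) i) (m≤n+m _ _)

∑∑-symmetrise : ∀ {n} (f : Fin n → Fin n → ℕ) →
  2 * ∑[ i < n ] ∑[ j < n ] f i j ≡ ∑[ i < n ] ∑[ j < n ] (f i j + f j i)
∑∑-symmetrise {n} f = begin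
  2 * ∑[ i < n ] ∑[ j < n ] f i j
    ≡⟨ cong (F +_) (trans (+-identityʳ F) (∑-comm f)) ⟩
  F + ∑[ i < n ] ∑[ j < n ] f j i
    ≡⟨ ∑-distrib-+ (λ i → ∑[ j < n ] f i j) (λ i → ∑[ j < n ] f j i) ⟨
  ∑[ i < n ] (∑[ j < n ] f i j + ∑[ j < n ] f j i)
    ≡⟨ sum-cong-≗ {n} (λ i → ∑-distrib-+ (f i) (λ j → f j i)) ⟨
  ∑[ i < n ] ∑[ j < n ] (f i j + f j i)
    ∎
  where
  open ≡-Reasoning
  F : ℕ
  F = ∑[ i < n ] ∑[ j < n ] f i j

∑∑-distrib-+ : ∀ {m n} (f g : Fin m → Fin n → ℕ) →
  ∑[ i < m ] ∑[ j < n ] (f i j + g i j)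
    ≡ ∑[ i < m ] ∑[ j < n ] f i j + ∑[ i < m ] ∑[ j < n ] g i j
∑∑-distrib-+ {m} {n} f g = trans (sum-cong-≗ {m} (λ i → ∑-distrib-+ (f i) (g i)))
                                 (∑-distrib-+ (λ i → ∑[ j < n ] f i j) (λ i → ∑[ j < n ] g i j))

∣∣-split : ∀ {n} (P Q R : Fin n → Bool) →
  (∀ i → indicator (P i) ≡ indicator (Q i) + indicator (R i)) → ∣ P ∣ ≡ ∣ Q ∣ + ∣ R ∣
∣∣-split {n} P Q R split =
  trans (sum-cong-≗ {n} split) (∑-distrib-+ (indicator ∘ Q) (indicator ∘ R))

∣∣-none : ∀ {n} (P : Fin n → Bool) → (∀ i → P i ≡ false) → ∣ P ∣ ≡ 0
∣∣-none {zero}  P none = refl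
∣∣-none {suc n} P none rewrite none zero = ∣∣-none (P ∘ suc) (none ∘ suc)

∣∣-all : ∀ n → ∣ (λ (_ : Fin n) → true) ∣ ≡ n
∣∣-all n = trans (∑-const n 1) (*-identityʳ n)

∣∣≤1 : ∀ {n} (P : Fin n → Bool) → (∀ i j → P i ≡ true → P j ≡ true → i ≡ j) → ∣ P ∣ ≤ 1
∣∣≤1 {zero}  P unique = z≤n
∣∣≤1 {suc n} P unique with P zero in P0
... | true  = ≤-reflexive (cong suc (∣∣-none (P ∘ suc) others))
  where
  others : ∀ i → P (suc i) ≡ false
  others i with P (suc i) in Pi
  ... | false = refl
  ... | true  with () ← unique zero (suc i) P0 Pi
... | false = ∣∣≤1 (P ∘ suc) (λ i j Pi Pj → Fin-suc-injective (unique (suc i) (suc j) Pi Pj))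

eqᵇ-refl : ∀ {n} (a : Fin n) → eqᵇ a a ≡ true
eqᵇ-refl a = dec-true (a ≟ a) refl

eqᵇ-≢ : ∀ {n} {a b : Fin n} → a ≢ b → eqᵇ a b ≡ false
eqᵇ-≢ {a = a} {b} a≢b = dec-false (a ≟ b) a≢b

eqᵇ⇒≡ : ∀ {n} {a b : Fin n} → eqᵇ a b ≡ true → a ≡ b
eqᵇ⇒≡ {a = a} {b} eq with a ≟ b
... | yes a≡b = a≡b

eqᵇ-comm : ∀ {n} (a b : Fin n) → eqᵇ a b ≡ eqᵇ b a
eqᵇ-comm a b = does-⇔ (mk⇔ ≡-sym ≡-sym) (a ≟ b) (b ≟ a)

∣eqᵇ∣ : ∀ {n} (a : Fin n) → ∣ eqᵇ a ∣ ≡ 1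
∣eqᵇ∣ {n} a = ≤-antisym
  (∣∣≤1 (eqᵇ a) (λ i j ai aj → trans (≡-sym (eqᵇ⇒≡ {a = a} ai)) (eqᵇ⇒≡ {a = a} aj)))
  (≤-trans (≤-reflexive (cong indicator (≡-sym (eqᵇ-refl a)))) (term≤∑ (indicator ∘ eqᵇ a) a))

∣∣-injection : ∀ {h n} (f : Fin h → Fin n) → Injective _≡_ _≡_ f →
  (P : Fin h → Bool) (Q : Fin n → Bool) → (∀ a → P a ≡ true → Q (f a) ≡ true) → ∣ P ∣ ≤ ∣ Q ∣
∣∣-injection {h} {n} f f-inj P Q P⇒Q = begin
  ∑[ a < h ] indicator (P a)                               ≤⟨ ∑-mono-≤ hit ⟩
  ∑[ a < h ] ∑[ v < n ] indicator (eqᵇ (f a) v ∧ Q v)      ≡⟨ ∑-comm (λ a v → indicator (eqᵇ (f a) v ∧ Q v)) ⟩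
  ∑[ v < n ] ∑[ a < h ] indicator (eqᵇ (f a) v ∧ Q v)      ≤⟨ ∑-mono-≤ fibre ⟩
  ∣ Q ∣                                                    ∎
  where
  open ≤-Reasoning
  hit : ∀ a → indicator (P a) ≤ ∑[ v < n ] indicator (eqᵇ (f a) v ∧ Q v)
  hit a with P a in Pa
  ... | false = z≤n
  ... | true  = ≤-trans (≤-reflexive (cong indicator (≡-sym hitᵇ))) (term≤∑ _ (f a))
    where
    hitᵇ : (eqᵇ (f a) (f a) ∧ Q (f a)) ≡ true
    hitᵇ rewrite eqᵇ-refl (f a) = P⇒Q a Pa
  fibre : ∀ v → ∑[ a < h ] indicator (eqᵇ (f a) v ∧ Q v) ≤ indicator (Q v)
  fibre v with Q v
  ... | false = ≤-reflexive (∣∣-none _ (λ a → ∧-zeroʳ (eqᵇ (f a) v)))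
  ... | true  = ∣∣≤1 _ (λ a b fa≡v fb≡v → f-inj (trans (at-v fa≡v) (≡-sym (at-v fb≡v))))
    where
    at-v : ∀ {a} → (eqᵇ (f a) v ∧ true) ≡ true → f a ≡ v
    at-v {a} e = eqᵇ⇒≡ (trans (≡-sym (∧-identityʳ (eqᵇ (f a) v))) e)

<⇒<ᵇ≡true : ∀ {m n} → m < n → (m <ᵇ n) ≡ true
<⇒<ᵇ≡true {m} {n} = dec-true (m <? n)

≥⇒<ᵇ≡false : ∀ {m n} → n ≤ m → (m <ᵇ n) ≡ false
≥⇒<ᵇ≡false {m} {n} n≤m = dec-false (m <? n) (≤⇒≯ n≤m)

<ᵇ≡true⇒< : ∀ m n → (m <ᵇ n) ≡ true → m < n
<ᵇ≡true⇒< m n eq = <ᵇ⇒< m n (subst T (≡-sym eq) tt)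

<ᵇ≡false⇒≥ : ∀ m n → (m <ᵇ n) ≡ false → n ≤ m
<ᵇ≡false⇒≥ m n eq = ≮⇒≥ (λ m<n → subst T eq (<⇒<ᵇ m<n))

below : ∀ {n} → ℕ → Fin n → Bool
below m i = toℕ i <ᵇ m

∣below∣≤ : ∀ n m → ∣ below {n} m ∣ ≤ m
∣below∣≤ zero    m       = z≤n
∣below∣≤ (suc n) zero    = ≤-reflexive (∣∣-none (below {suc n} 0 ∘ suc) (λ _ → refl))
∣below∣≤ (suc n) (suc m) = s≤s (∣below∣≤ n m)

≡ᵇ-refl : ∀ m → (m ≡ᵇ m) ≡ true
≡ᵇ-refl m = dec-true (m ≟ℕ m) refl

≡ᵇ≡true⇒≡ : ∀ {m n} → (m ≡ᵇ n) ≡ true → m ≡ n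
≡ᵇ≡true⇒≡ {m} {n} eq = ≡ᵇ⇒≡ m n (subst T (≡-sym eq) tt)

-- Edges and common neighbours

adj⇒≢ : ∀ {n} (G : Graph n) {a b} → adj G a b ≡ true → a ≢ b
adj⇒≢ G {a} ab refl with () ← trans (≡-sym (Graph.irrefl G a)) ab

common : ∀ {n} → Graph n → Fin n → Fin n → ℕ
common G x y = ∣ (λ z → adj G x z ∧ adj G y z) ∣

NonEdgesHaveCommonNeighbours : ∀ {n} → Graph n → ℕ → Set
NonEdgesHaveCommonNeighbours {n} G t = ∀ (x y : Fin n) → x ≢ y → adj G x y ≡ false → t ≤ common G x y

module _ {n : ℕ} (G : Graph n) where

  numEdges≡∑ : numEdges G ≡ ∑[ i < n ] ∑[ j < n ] indicator ((toℕ i <ᵇ toℕ j) ∧ adj G i j)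
  numEdges≡∑ = trans (sum-map-tabulate n _ (λ i → i)) (sum-cong-≗ {n} (λ i → count≡∣∣ n _))

  indicator-adj-by-order : ∀ i j → indicator (adj G i j)
    ≡ indicator ((toℕ i <ᵇ toℕ j) ∧ adj G i j) + indicator ((toℕ j <ᵇ toℕ i) ∧ adj G j i)
  indicator-adj-by-order i j rewrite Graph.sym G j i with <-cmp (toℕ i) (toℕ j)
  ... | tri< i<j _ _ rewrite <⇒<ᵇ≡true i<j | ≥⇒<ᵇ≡false (<⇒≤ i<j) = ≡-sym (+-identityʳ _)
  ... | tri> _ _ j<i rewrite <⇒<ᵇ≡true j<i | ≥⇒<ᵇ≡false (<⇒≤ j<i) = refl
  ... | tri≈ _ i≡j _ rewrite toℕ-injective i≡j | Graph.irrefl G j | ∧-zeroʳ (toℕ j <ᵇ toℕ j) = refl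

  handshake : 2 * numEdges G ≡ ∑[ i < n ] ∣ adj G i ∣
  handshake = trans (cong (2 *_) numEdges≡∑) (trans (∑∑-symmetrise ordered)
    (sum-cong-≗ {n} (λ i → sum-cong-≗ {n} (≡-sym ∘ indicator-adj-by-order i))))
    where
    ordered : Fin n → Fin n → ℕ
    ordered i j = indicator ((toℕ i <ᵇ toℕ j) ∧ adj G i j)

  crossEdges≤numEdges : (S T : Fin n → Bool) → (∀ i → (S i ∧ T i) ≡ false) →
    ∑[ i < n ] ∑[ j < n ] indicator (S i ∧ (T j ∧ adj G i j)) ≤ numEdges G
  crossEdges≤numEdges S T disjoint = *-cancelˡ-≤ 2 (begin
    2 * ∑[ i < n ] ∑[ j < n ] cross i j           ≡⟨ ∑∑-symmetrise cross ⟩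
    ∑[ i < n ] ∑[ j < n ] (cross i j + cross j i) ≤⟨ ∑-mono-≤ (λ i → ∑-mono-≤ (atMostOnce i)) ⟩
    ∑[ i < n ] ∣ adj G i ∣                        ≡⟨ handshake ⟨
    2 * numEdges G                                ∎)
    where
    open ≤-Reasoning
    cross : Fin n → Fin n → ℕ
    cross i j = indicator (S i ∧ (T j ∧ adj G i j))
    atMostOnce : ∀ i j → cross i j + cross j i ≤ indicator (adj G i j)
    atMostOnce i j rewrite Graph.sym G j i = indicator-disjoint (S j) (T j) (adj G i j) (disjoint i)

  ∣∣*≤numEdges : (S T : Fin n → Bool) → (∀ i → (S i ∧ T i) ≡ false) → (t : ℕ) →
    (∀ i → S i ≡ true → t ≤ ∣ (λ j → T j ∧ adj G i j) ∣) → ∣ S ∣ * t ≤ numEdges G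
  ∣∣*≤numEdges S T disjoint t many = begin
    ∣ S ∣ * t                                                 ≡⟨ *-distribʳ-sum t (indicator ∘ S) ⟩
    ∑[ i < n ] (indicator (S i) * t)                          ≤⟨ ∑-mono-≤ row ⟩
    ∑[ i < n ] ∑[ j < n ] indicator (S i ∧ (T j ∧ adj G i j))
                                              ≤⟨ crossEdges≤numEdges S T disjoint ⟩
    numEdges G                                                ∎
    where
    open ≤-Reasoning
    row : ∀ i → indicator (S i) * t ≤ ∑[ j < n ] indicator (S i ∧ (T j ∧ adj G i j))
    row i with S i in Si
    ... | false = z≤n
    ... | true  = ≤-trans (≤-reflexive (+-identityʳ t)) (many i Si)

  nonNeighbours : Fin n → Fin n → Bool
  nonNeighbours x i = not (eqᵇ x i) ∧ not (adj G x i)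

  nonNeighbours+degree : ∀ x → ∣ nonNeighbours x ∣ + ∣ adj G x ∣ + 1 ≡ n
  nonNeighbours+degree x = begin
    ∣ nonNeighbours x ∣ + ∣ adj G x ∣ + 1
      ≡⟨ cong₂ _+_ (∑-distrib-+ nn neighbour) (∣eqᵇ∣ x) ⟨
    ∑[ i < n ] (nn i + neighbour i) + ∣ eqᵇ x ∣
      ≡⟨ ∑-distrib-+ (λ i → nn i + neighbour i) (indicator ∘ eqᵇ x) ⟨
    ∑[ i < n ] (nn i + neighbour i + indicator (eqᵇ x i))
      ≡⟨ sum-cong-≗ {n} partition ⟩
    ∣ (λ (_ : Fin n) → true) ∣
      ≡⟨ ∣∣-all n ⟩
    n ∎
    where
    open ≡-Reasoning
    nn neighbour : Fin n → ℕ
    nn = indicator ∘ nonNeighbours x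
    neighbour = indicator ∘ adj G x
    partition : ∀ i → nn i + neighbour i + indicator (eqᵇ x i) ≡ 1
    partition i with x ≟ i
    ... | yes refl rewrite Graph.irrefl G x = refl
    ... | no _ with adj G x i
    ...   | true  = refl
    ...   | false = refl

  minDegree*n≤2*numEdges : ∀ d → (∀ x → d ≤ ∣ adj G x ∣) → d * n ≤ 2 * numEdges G
  minDegree*n≤2*numEdges d d≤deg = begin
    d * n                    ≡⟨ *-comm d n ⟩
    n * d                    ≡⟨ ∑-const n d ⟨
    ∑[ x < n ] d             ≤⟨ ∑-mono-≤ d≤deg ⟩
    ∑[ x < n ] ∣ adj G x ∣   ≡⟨ handshake ⟨
    2 * numEdges G           ∎
    where open ≤-Reasoning

  lowDegree⇒edges-lower-bound : ∀ t → NonEdgesHaveCommonNeighbours G t →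
    ∀ x → ∣ adj G x ∣ < 2 * t → t * n ≤ numEdges G + t * (2 * t)
  lowDegree⇒edges-lower-bound t commonNeighbours x small = begin
    t * n                    ≡⟨ cong (t *_) (nonNeighbours+degree x) ⟨
    t * (a + d + 1)          ≡⟨ cong (t *_) (+-assoc a d 1) ⟩
    t * (a + (d + 1))        ≡⟨ *-distribˡ-+ t a (d + 1) ⟩
    t * a + t * (d + 1)      ≤⟨ +-mono-≤ (≤-trans (≤-reflexive (*-comm t a)) farEdges)
                                         (*-monoʳ-≤ t (≤-trans (≤-reflexive (+-comm d 1)) small)) ⟩
    numEdges G + t * (2 * t) ∎
    where
    open ≤-Reasoning
    a d : ℕ
    a = ∣ nonNeighbours x ∣
    d = ∣ adj G x ∣
    disjoint : ∀ i → (nonNeighbours x i ∧ adj G x i) ≡ false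
    disjoint i with adj G x i
    ... | true  = trans (∧-identityʳ _) (∧-zeroʳ (not (eqᵇ x i)))
    ... | false = ∧-zeroʳ _
    far : ∀ i → nonNeighbours x i ≡ true → t ≤ ∣ (λ j → adj G x j ∧ adj G i j) ∣
    far i nonNeighbour with x ≟ i | adj G x i in xi
    ... | no x≢i | false = commonNeighbours x i x≢i xi
    farEdges : a * t ≤ numEdges G
    farEdges = ∣∣*≤numEdges (nonNeighbours x) (adj G x) disjoint t far

  edges-lower-bound : ∀ t → NonEdgesHaveCommonNeighbours G t → t * n ≤ numEdges G + t * (2 * t)
  edges-lower-bound t commonNeighbours with any? (λ x → ∣ adj G x ∣ <? 2 * t)
  ... | yes (x , small) = lowDegree⇒edges-lower-bound t commonNeighbours x small
  ... | no noneSmall    = ≤-trans (*-cancelˡ-≤ 2 twice) (m≤m+n (numEdges G) (t * (2 * t)))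
    where
    twice : 2 * (t * n) ≤ 2 * numEdges G
    twice = subst (_≤ 2 * numEdges G) (*-assoc 2 t n)
      (minDegree*n≤2*numEdges (2 * t) (λ x → ≮⇒≥ (λ small → noneSmall (x , small))))

-- Saturation

module _ {n} (G : Graph n) {x y : Fin n} (x≢y : x ≢ y) where

  addEdge-⊇ : ∀ {a b} → adj G a b ≡ true → adj (addEdge G x y x≢y) a b ≡ true
  addEdge-⊇ ab rewrite ab = refl

  addEdge-new : ∀ {a b} → adj (addEdge G x y x≢y) a b ≡ true → adj G a b ≡ false →
    (a ≡ x × b ≡ y) ⊎ (a ≡ y × b ≡ x)
  addEdge-new {a} {b} ab¹ ab rewrite ab with a ≟ x | b ≟ y | a ≟ y | b ≟ x
  ... | yes a≡x | yes b≡y | _       | _       = inj₁ (a≡x , b≡y)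
  ... | _       | _       | yes a≡y | yes b≡x = inj₂ (a≡y , b≡x)
  ... | no _    | _       | no _    | _       with () ← ab¹
  ... | no _    | _       | yes _   | no _    with () ← ab¹
  ... | yes _   | no _    | no _    | _       with () ← ab¹
  ... | yes _   | no _    | yes _   | no _    with () ← ab¹

  addEdge-away : ∀ a {b} → b ≢ x → b ≢ y → adj (addEdge G x y x≢y) a b ≡ adj G a b
  addEdge-away a b≢x b≢y
    rewrite eqᵇ-≢ b≢x | eqᵇ-≢ b≢y | ∧-zeroʳ (eqᵇ a x) | ∧-zeroʳ (eqᵇ a y) = ∨-identityʳ _

  addEdge-xy : adj (addEdge G x y x≢y) x y ≡ true
  addEdge-xy rewrite eqᵇ-refl x | eqᵇ-refl y = ∨-zeroʳ (adj G x y)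

  addEdge-yx : adj (addEdge G x y x≢y) y x ≡ true
  addEdge-yx rewrite eqᵇ-refl x | eqᵇ-refl y =
    trans (cong (adj G y x ∨_) (∨-zeroʳ (eqᵇ y x ∧ eqᵇ x y))) (∨-zeroʳ (adj G y x))

  addEdge-comm : ∀ a b → adj (addEdge G y x (x≢y ∘ ≡-sym)) a b ≡ adj (addEdge G x y x≢y) a b
  addEdge-comm a b = cong (adj G a b ∨_) (∨-comm (eqᵇ a y ∧ eqᵇ b x) (eqᵇ a x ∧ eqᵇ b y))

EdgesHaveCommonNeighbours : ∀ {h} → Graph h → ℕ → Set
EdgesHaveCommonNeighbours {h} H t = ∀ (a b : Fin h) → adj H a b ≡ true → t ≤ common H a b

copy-through-new-edge : ∀ {h n} (H : Graph h) (G : Graph n) {x y : Fin n} (x≢y : x ≢ y)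
  (f : Fin h → Fin n) → Injective _≡_ _≡_ f →
  (∀ a b → adj H a b ≡ true → adj (addEdge G x y x≢y) (f a) (f b) ≡ true) →
  ∀ {a b} → adj H a b ≡ true → adj G (f a) (f b) ≡ false → common H a b ≤ common G x y
copy-through-new-edge H G {x} {y} x≢y f f-inj hom {a} {b} ab fab =
  ∣∣-injection f f-inj _ _ (λ c ac∧bc → commonImage c (∧-true ac∧bc))
  where
  ∧-true : ∀ {p q} → (p ∧ q) ≡ true → p ≡ true × q ≡ true
  ∧-true {true} {true} _ = refl , refl
  ends : (f a ≡ x × f b ≡ y) ⊎ (f a ≡ y × f b ≡ x)
  ends = addEdge-new G x≢y (hom a b ab) fab
  avoids : ∀ {c} → adj H a c ≡ true → adj H b c ≡ true → f c ≢ f a × f c ≢ f b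
  avoids ac bc = (λ e → adj⇒≢ H ac (≡-sym (f-inj e))) , (λ e → adj⇒≢ H bc (≡-sym (f-inj e)))
  outside : ∀ {c} → adj H a c ≡ true → adj H b c ≡ true → f c ≢ x × f c ≢ y
  outside ac bc with ends | avoids ac bc
  ... | inj₁ (refl , refl) | ≢fa , ≢fb = ≢fa , ≢fb
  ... | inj₂ (refl , refl) | ≢fa , ≢fb = ≢fb , ≢fa
  inG : ∀ {c} d → adj H d c ≡ true → f c ≢ x × f c ≢ y → adj G (f d) (f c) ≡ true
  inG {c} d dc (≢x , ≢y) = trans (≡-sym (addEdge-away G x≢y (f d) ≢x ≢y)) (hom d c dc)
  image : ∀ {u v w} → (u ≡ x × v ≡ y) ⊎ (u ≡ y × v ≡ x) →
    adj G u w ≡ true → adj G v w ≡ true → (adj G x w ∧ adj G y w) ≡ true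
  image (inj₁ (refl , refl)) uw vw rewrite uw | vw = refl
  image (inj₂ (refl , refl)) uw vw rewrite uw | vw = refl
  commonImage : ∀ c → adj H a c ≡ true × adj H b c ≡ true → (adj G x (f c) ∧ adj G y (f c)) ≡ true
  commonImage c (ac , bc) = image ends (inG a ac (outside ac bc)) (inG b bc (outside ac bc))

-- Deciding the conclusion spares us from locating the edge of the copy that lands on xy:
-- if the bound fails, every edge of the copy already lies in G.
saturated⇒nonEdgesHaveCommonNeighbours : ∀ {h n} {H : Graph h} {G : Graph n} {t} →
  EdgesHaveCommonNeighbours H t → Saturated H G → NonEdgesHaveCommonNeighbours G t
saturated⇒nonEdgesHaveCommonNeighbours {H = H} {G} {t} edgesCommon (free , saturate) x y x≢y xy
  with t ≤? common G x y | saturate x y x≢y xy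
... | yes enough | _               = enough
... | no tooFew  | f , f-inj , hom = contradiction (f , (λ {a} {b} → f-inj) , homG) free
  where
  homG : ∀ a b → adj H a b ≡ true → adj G (f a) (f b) ≡ true
  homG a b ab with adj G (f a) (f b) in fab
  ... | true  = refl
  ... | false = contradiction
    (≤-trans (edgesCommon a b ab) (copy-through-new-edge H G x≢y f f-inj hom ab fab)) tooFew

-- Disjoint unions of cliques

cliqueSizeOf : (ps : List ℕ) → ℕ → ℕ
cliqueSizeOf ps m = ∣ (λ c → m ≡ᵇ comp ps c) ∣

cliqueSize : (ps : List ℕ) → Fin (sum ps) → ℕ
cliqueSize ps a = cliqueSizeOf ps (comp ps a)

comp-inj₁ : ∀ q qs {a : Fin (q + sum qs)} {i} → splitAt q a ≡ inj₁ i → comp (q ∷ qs) a ≡ 0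
comp-inj₁ q qs eq rewrite eq = refl

comp-inj₂ : ∀ q qs {a : Fin (q + sum qs)} {j} → splitAt q a ≡ inj₂ j → comp (q ∷ qs) a ≡ suc (comp qs j)
comp-inj₂ q qs eq rewrite eq = refl

cliqueSizeOf-split : ∀ q qs m → cliqueSizeOf (q ∷ qs) m
  ≡ ∑[ i < q ] indicator (m ≡ᵇ 0) + ∑[ j < sum qs ] indicator (m ≡ᵇ suc (comp qs j))
cliqueSizeOf-split q qs m = trans (∑-↑ q (sum qs) _) (cong₂ _+_
  (sum-cong-≗ {q} (λ i → cong (λ c → indicator (m ≡ᵇ c))
                               (comp-inj₁ q qs (splitAt-↑ˡ q i (sum qs)))))
  (sum-cong-≗ {sum qs} (λ j → cong (λ c → indicator (m ≡ᵇ c))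
                                    (comp-inj₂ q qs (splitAt-↑ʳ q (sum qs) j)))))

cliqueSizeOf-zero : ∀ q qs → cliqueSizeOf (q ∷ qs) 0 ≡ q
cliqueSizeOf-zero q qs = begin
  cliqueSizeOf (q ∷ qs) 0          ≡⟨ cliqueSizeOf-split q qs 0 ⟩
  ∑[ i < q ] 1 + ∑[ j < sum qs ] 0  ≡⟨ cong₂ _+_ (∣∣-all q) (∣∣-none (λ (_ : Fin (sum qs)) → false) (λ _ → refl)) ⟩
  q + 0                            ≡⟨ +-identityʳ q ⟩
  q                                ∎
  where open ≡-Reasoning

cliqueSizeOf-suc : ∀ q qs m → cliqueSizeOf (q ∷ qs) (suc m) ≡ cliqueSizeOf qs m
cliqueSizeOf-suc q qs m = trans (cliqueSizeOf-split q qs (suc m))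
  (cong (_+ cliqueSizeOf qs m) (∣∣-none (λ (_ : Fin q) → false) (λ _ → refl)))

cliqueSize-≥ : ∀ {p} ps → All (p ≤_) ps → ∀ a → p ≤ cliqueSize ps a
cliqueSize-≥ (q ∷ qs) (p≤q ∷ p≤qs) a with splitAt q a
... | inj₁ _ = subst (_ ≤_) (≡-sym (cliqueSizeOf-zero q qs)) p≤q
... | inj₂ j = subst (_ ≤_) (≡-sym (cliqueSizeOf-suc q qs (comp qs j))) (cliqueSize-≥ qs p≤qs j)

module _ (ps : List ℕ) where

  private
    H : Graph (sum ps)
    H = cliqueUnion ps

  cliqueUnion-adj⇒sameComp : ∀ {a b} → adj H a b ≡ true → comp ps a ≡ comp ps b
  cliqueUnion-adj⇒sameComp {a} {b} ab with eqᵇ a b | comp ps a ≡ᵇ comp ps b in same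
  ... | false | true = ≡ᵇ≡true⇒≡ same

  suc-degree≡cliqueSize : ∀ a → suc ∣ adj H a ∣ ≡ cliqueSize ps a
  suc-degree≡cliqueSize a = ≡-sym (begin
    cliqueSize ps a              ≡⟨ ∣∣-split _ (adj H a) (eqᵇ a) split ⟩
    ∣ adj H a ∣ + ∣ eqᵇ a ∣      ≡⟨ cong (∣ adj H a ∣ +_) (∣eqᵇ∣ a) ⟩
    ∣ adj H a ∣ + 1              ≡⟨ +-comm (∣ adj H a ∣) 1 ⟩
    suc (∣ adj H a ∣)            ∎)
    where
    open ≡-Reasoning
    split : ∀ c → indicator (comp ps a ≡ᵇ comp ps c) ≡ indicator (adj H a c) + indicator (eqᵇ a c)
    split c with a ≟ c
    ... | yes refl rewrite ≡ᵇ-refl (comp ps a) = refl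
    ... | no _ with comp ps a ≡ᵇ comp ps c
    ...   | true  = refl
    ...   | false = refl

  module _ {u v} (uv : adj H u v ≡ true) where

    suc-common≡degree : suc (common H u v) ≡ ∣ adj H u ∣
    suc-common≡degree = ≡-sym (begin
      ∣ adj H u ∣                  ≡⟨ ∣∣-split (adj H u) _ (eqᵇ v) split ⟩
      common H u v + ∣ eqᵇ v ∣     ≡⟨ cong (common H u v +_) (∣eqᵇ∣ v) ⟩
      common H u v + 1             ≡⟨ +-comm (common H u v) 1 ⟩
      suc (common H u v)           ∎)
      where
      open ≡-Reasoning
      split : ∀ w → indicator (adj H u w) ≡ indicator (adj H u w ∧ adj H v w) + indicator (eqᵇ v w)
      split w with v ≟ w
      ... | yes refl rewrite uv = refl
      ... | no _ rewrite cliqueUnion-adj⇒sameComp uv with eqᵇ u w | comp ps v ≡ᵇ comp ps w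
      ...   | true  | _     = refl
      ...   | false | true  = refl
      ...   | false | false = refl

    ∣N[v]∖N[u]∣≡1 : ∣ (λ w → adj H v w ∧ not (adj H u w)) ∣ ≡ 1
    ∣N[v]∖N[u]∣≡1 = trans (sum-cong-≗ {sum ps} onlyU) (∣eqᵇ∣ u)
      where
      onlyU : ∀ w → indicator (adj H v w ∧ not (adj H u w)) ≡ indicator (eqᵇ u w)
      onlyU w with u ≟ w
      ... | yes refl rewrite trans (Graph.sym H v u) uv = refl
      ... | no _ rewrite cliqueUnion-adj⇒sameComp uv with eqᵇ v w | comp ps v ≡ᵇ comp ps w
      ...   | true  | _     = refl
      ...   | false | true  = refl
      ...   | false | false = refl

    common≡cliqueSize∸2 : common H u v ≡ cliqueSize ps u ∸ 2
    common≡cliqueSize∸2 = cong (_∸ 2) (trans (cong suc suc-common≡degree) (suc-degree≡cliqueSize u))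

    wtOriented-cliqueUnion : wtOriented H u v ≡ 2 * (cliqueSize ps u ∸ 2) + 1
    wtOriented-cliqueUnion = cong₂ (λ c e → 2 * c + e)
      (trans (count≡∣∣ (sum ps) _) common≡cliqueSize∸2)
      (trans (count≡∣∣ (sum ps) _) ∣N[v]∖N[u]∣≡1)

  edgeWt-cliqueUnion : ∀ {u v} → adj H u v ≡ true → edgeWt H u v ≡ 2 * (cliqueSize ps u ∸ 2) + 1
  edgeWt-cliqueUnion {u} {v} uv with deg H u ≤ᵇ deg H v
  ... | true  = wtOriented-cliqueUnion uv
  ... | false = trans (wtOriented-cliqueUnion (trans (Graph.sym H v u) uv))
                      (cong (λ m → 2 * (cliqueSizeOf ps m ∸ 2) + 1) (≡-sym (cliqueUnion-adj⇒sameComp uv)))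

  cliqueUnion-edgesHaveCommonNeighbours : ∀ {p} → All (p ≤_) ps → EdgesHaveCommonNeighbours H (p ∸ 2)
  cliqueUnion-edgesHaveCommonNeighbours p≤ps a b ab =
    subst (_ ≤_) (≡-sym (common≡cliqueSize∸2 ab)) (∸-monoˡ-≤ 2 (cliqueSize-≥ ps p≤ps a))

cliqueUnion-wt : ∀ c qs → All (suc (suc c) ≤_) qs → IsWt (cliqueUnion (suc (suc c) ∷ qs)) (2 * c + 1)
cliqueUnion-wt c qs p≤qs = (zero , suc zero , refl , firstEdge) , lightest
  where
  ps : List ℕ
  ps = suc (suc c) ∷ qs
  p≤ps : All (suc (suc c) ≤_) ps
  p≤ps = ≤-refl ∷ p≤qs
  firstEdge : edgeWt (cliqueUnion ps) zero (suc zero) ≡ 2 * c + 1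
  firstEdge = trans (edgeWt-cliqueUnion ps {zero} {suc zero} refl)
                    (cong (λ m → 2 * (m ∸ 2) + 1) (cliqueSizeOf-zero (suc (suc c)) qs))
  lightest : ∀ u v → adj (cliqueUnion ps) u v ≡ true → 2 * c + 1 ≤ edgeWt (cliqueUnion ps) u v
  lightest u v uv = subst (2 * c + 1 ≤_) (≡-sym (edgeWt-cliqueUnion ps {u} {v} uv))
    (+-monoˡ-≤ 1 (*-monoʳ-≤ 2 (∸-monoˡ-≤ 2 (cliqueSize-≥ ps p≤ps u))))

-- A saturated graph with few edges

module _ (c k : ℕ) where

  link : ℕ → ℕ → Bool
  link a b = ((a <ᵇ k) ∧ (b <ᵇ k)) ∨ ((a <ᵇ c) ∨ (b <ᵇ c))

  universalClique : ∀ n → Graph n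
  universalClique n = record
    { adj    = λ u v → not (eqᵇ u v) ∧ link (toℕ u) (toℕ v)
    ; sym    = λ u v → cong₂ (λ e l → not e ∧ l) (eqᵇ-comm u v)
                 (cong₂ _∨_ (∧-comm (toℕ u <ᵇ k) _) (∨-comm (toℕ u <ᵇ c) _))
    ; irrefl = λ u → cong (λ e → not e ∧ link (toℕ u) (toℕ u)) (eqᵇ-refl u)
    }

  orderedEdge≤ : ∀ a b e → indicator ((a <ᵇ b) ∧ (not e ∧ link a b))
    ≤ indicator ((a <ᵇ k) ∧ (b <ᵇ k)) + indicator (a <ᵇ c)
  orderedEdge≤ a b e with a <ᵇ c in ac | b <ᵇ c in bc
  ... | true  | _     = ≤-trans (indicator≤1 _) (m≤n+m 1 (indicator ((a <ᵇ k) ∧ (b <ᵇ k))))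
  ... | false | false rewrite ∨-identityʳ ((a <ᵇ k) ∧ (b <ᵇ k)) =
    ≤-trans (indicator-∧ (a <ᵇ b) _) (≤-trans (indicator-∧ (not e) _) (m≤m+n _ 0))
  ... | false | true rewrite ∨-zeroʳ ((a <ᵇ k) ∧ (b <ᵇ k)) with a <ᵇ b in ab
  ...   | false = z≤n
  ...   | true  =
    contradiction (<-trans (<ᵇ≡true⇒< a b ab) (<ᵇ≡true⇒< b c bc)) (≤⇒≯ (<ᵇ≡false⇒≥ a c ac))

  numEdges-universalClique : ∀ n → numEdges (universalClique n) ≤ c * n + k * k
  numEdges-universalClique n = begin
    numEdges (universalClique n)
      ≡⟨ numEdges≡∑ (universalClique n) ⟩
    ∑[ i < n ] ∑[ j < n ] indicator ((toℕ i <ᵇ toℕ j) ∧ adj (universalClique n) i j)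
      ≤⟨ ∑-mono-≤ {n} (λ i → ∑-mono-≤ {n} (λ j → orderedEdge≤ (toℕ i) (toℕ j) (eqᵇ i j))) ⟩
    ∑[ i < n ] ∑[ j < n ] (indicator (inK i ∧ inK j) + indicator (inC i))
      ≡⟨ ∑∑-distrib-+ (λ i j → indicator (inK i ∧ inK j)) (λ i _ → indicator (inC i)) ⟩
    ∑[ i < n ] ∑[ j < n ] indicator (inK i ∧ inK j) + ∑[ i < n ] ∑[ j < n ] indicator (inC i)
      ≡⟨ cong₂ _+_ square strip ⟩
    ∣ inK ∣ * ∣ inK ∣ + n * ∣ inC ∣
      ≤⟨ +-mono-≤ (*-mono-≤ (∣below∣≤ n k) (∣below∣≤ n k)) (*-monoʳ-≤ n (∣below∣≤ n c)) ⟩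
    k * k + n * c
      ≡⟨ trans (+-comm (k * k) (n * c)) (cong (_+ k * k) (*-comm n c)) ⟩
    c * n + k * k ∎
    where
    open ≤-Reasoning
    inK inC : Fin n → Bool
    inK = below k
    inC = below c
    square : ∑[ i < n ] ∑[ j < n ] indicator (inK i ∧ inK j) ≡ ∣ inK ∣ * ∣ inK ∣
    square = begin-equality
      ∑[ i < n ] ∑[ j < n ] indicator (inK i ∧ inK j)
        ≡⟨ sum-cong-≗ {n} (λ i → trans (sum-cong-≗ {n} (λ j → indicator-∧-* (inK i) (inK j)))
                                        (∑-*ˡ (indicator (inK i)) (indicator ∘ inK))) ⟩
      ∑[ i < n ] (indicator (inK i) * ∣ inK ∣)
        ≡⟨ *-distribʳ-sum ∣ inK ∣ (indicator ∘ inK) ⟨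
      ∣ inK ∣ * ∣ inK ∣ ∎
    strip : ∑[ i < n ] ∑[ j < n ] indicator (inC i) ≡ n * ∣ inC ∣
    strip = trans (sum-cong-≗ {n} (λ i → ∑-const n (indicator (inC i)))) (∑-*ˡ n (indicator ∘ inC))

  farNeighbour : ∀ {n} {u v : Fin n} → c ≤ k → k ≤ toℕ u → adj (universalClique n) u v ≡ true → toℕ v < c
  farNeighbour {u = u} {v} c≤k k≤u uv
    rewrite ≥⇒<ᵇ≡false k≤u | ≥⇒<ᵇ≡false (≤-trans c≤k k≤u) with eqᵇ u v | toℕ v <ᵇ c in vc
  ... | false | true = <ᵇ≡true⇒< (toℕ v) c vc

  universalClique-free : ∀ {h n} (H : Graph h) → c ≤ k → (∀ a → c < ∣ adj H a ∣) → k < h →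
    HFree H (universalClique n)
  universalClique-free {h} {n} H c≤k dense k<h (f , f-inj , hom) =
    <⇒≱ k<h (≤-trans (subst (_≤ ∣ below {n} k ∣) (∣∣-all h) allBelowK) (∣below∣≤ n k))
    where
    belowK : ∀ a → below k (f a) ≡ true
    belowK a with below k (f a) in fa
    ... | true  = refl
    ... | false = contradiction
      (≤-trans (∣∣-injection f f-inj (adj H a) (below c) neighbourLow) (∣below∣≤ n c)) (<⇒≱ (dense a))
      where
      neighbourLow : ∀ b → adj H a b ≡ true → below c (f b) ≡ true
      neighbourLow b ab = <⇒<ᵇ≡true (farNeighbour c≤k (<ᵇ≡false⇒≥ _ k fa) (hom a b ab))
    allBelowK : ∣ (λ (_ : Fin h) → true) ∣ ≤ ∣ below {n} k ∣
    allBelowK = ∣∣-injection f f-inj _ (below k) (λ a _ → belowK a)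

  universal-adj : ∀ {n} {u v : Fin n} → u ≢ v → toℕ u < c → adj (universalClique n) u v ≡ true
  universal-adj {u = u} {v} u≢v u<c rewrite eqᵇ-≢ u≢v | <⇒<ᵇ≡true u<c =
    ∨-zeroʳ ((toℕ u <ᵇ k) ∧ (toℕ v <ᵇ k))

  clique-adj : ∀ {n} {u v : Fin n} → u ≢ v → toℕ u < k → toℕ v < k → adj (universalClique n) u v ≡ true
  clique-adj u≢v u<k v<k rewrite eqᵇ-≢ u≢v | <⇒<ᵇ≡true u<k | <⇒<ᵇ≡true v<k = refl

  nonEdge⇒far : ∀ {n} {x y : Fin n} → x ≢ y → adj (universalClique n) x y ≡ false →
    c ≤ toℕ x × c ≤ toℕ y × (k ≤ toℕ x ⊎ k ≤ toℕ y)
  nonEdge⇒far {n} {x} {y} x≢y xy = ≮⇒≥ (notEdge ∘ universal-adj x≢y) , ≮⇒≥ (notEdge ∘ yx) , far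
    where
    notEdge : adj (universalClique n) x y ≢ true
    notEdge e with () ← trans (≡-sym xy) e
    yx : toℕ y < c → adj (universalClique n) x y ≡ true
    yx y<c = trans (Graph.sym (universalClique n) x y) (universal-adj (x≢y ∘ ≡-sym) y<c)
    far : k ≤ toℕ x ⊎ k ≤ toℕ y
    far with toℕ y <? k
    ... | no  y≮k = inj₂ (≮⇒≥ y≮k)
    ... | yes y<k = inj₁ (≮⇒≥ (λ x<k → notEdge (clique-adj x≢y x<k y<k)))

skip : ℕ → ℕ → ℕ
skip x m = if m <ᵇ x then m else suc m

skip-≢ : ∀ x m → skip x m ≢ x
skip-≢ x m with m <ᵇ x in m<x
... | true  = <⇒≢ (<ᵇ≡true⇒< m x m<x)
... | false = >⇒≢ (s≤s (<ᵇ≡false⇒≥ m x m<x))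

skip-injective : ∀ x {m m′} → skip x m ≡ skip x m′ → m ≡ m′
skip-injective x {m} {m′} eq with m <ᵇ x in m<x | m′ <ᵇ x in m′<x
... | true  | true  = eq
... | false | false = suc-injective eq
... | true  | false = contradiction (<ᵇ≡true⇒< m x m<x)
  (≤⇒≯ (≤-trans (<ᵇ≡false⇒≥ m′ x m′<x) (≤-trans (n≤1+n m′) (≤-reflexive (≡-sym eq)))))
... | false | true  = contradiction (<ᵇ≡true⇒< m′ x m′<x)
  (≤⇒≯ (≤-trans (<ᵇ≡false⇒≥ m x m<x) (≤-trans (n≤1+n m) (≤-reflexive eq))))

m≤skip : ∀ x m → m ≤ skip x m
m≤skip x m with m <ᵇ x
... | true  = ≤-refl
... | false = n≤1+n m

skip≤suc : ∀ x m → skip x m ≤ suc m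
skip≤suc x m with m <ᵇ x
... | true  = n≤1+n m
... | false = ≤-refl

module Embedding (c : ℕ) (qs : List ℕ) {n : ℕ} {x y : Fin n} (x≢y : x ≢ y)
                 (c≤x : c ≤ toℕ x) (k≤y : suc (c + sum qs) ≤ toℕ y) where

  private
    M k : ℕ
    M = sum qs
    k = suc (c + M)
    ps : List ℕ
    ps = suc (suc c) ∷ qs
    H : Graph (sum ps)
    H = cliqueUnion ps
    G : Graph n
    G = universalClique c k n

  -- The first clique of H goes to x, y and the universal vertices; the others fill [c, k) with x
  -- skipped.
  place : Fin (suc (suc c)) ⊎ Fin M → ℕ
  place (inj₁ zero)          = toℕ x
  place (inj₁ (suc zero))    = toℕ y
  place (inj₁ (suc (suc j))) = toℕ j
  place (inj₂ j)             = skip (toℕ x) (c + toℕ j)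

  rest<k : ∀ j → place (inj₂ j) < k
  rest<k j = s≤s (begin
    skip (toℕ x) (c + toℕ j) ≤⟨ skip≤suc (toℕ x) (c + toℕ j) ⟩
    suc (c + toℕ j)          ≡⟨ +-suc c (toℕ j) ⟨
    c + suc (toℕ j)          ≤⟨ +-monoʳ-≤ c (toℕ<n j) ⟩
    c + M                    ∎)
    where open ≤-Reasoning

  low<x : ∀ (j : Fin c) → toℕ j < toℕ x
  low<x j = <-≤-trans (toℕ<n j) c≤x

  low<y : ∀ (j : Fin c) → toℕ j < toℕ y
  low<y j = <-≤-trans (toℕ<n j) (≤-trans (≤-trans (m≤m+n c M) (n≤1+n _)) k≤y)

  low<rest : ∀ (j : Fin c) j′ → toℕ j < place (inj₂ j′)
  low<rest j j′ = <-≤-trans (toℕ<n j) (≤-trans (m≤m+n c (toℕ j′)) (m≤skip (toℕ x) (c + toℕ j′)))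

  rest<y : ∀ j → place (inj₂ j) < toℕ y
  rest<y j = <-≤-trans (rest<k j) k≤y

  x≢y′ : toℕ x ≢ toℕ y
  x≢y′ = x≢y ∘ toℕ-injective

  place<n : ∀ s → place s < n
  place<n (inj₁ zero)          = toℕ<n x
  place<n (inj₁ (suc zero))    = toℕ<n y
  place<n (inj₁ (suc (suc j))) = <-trans (low<x j) (toℕ<n x)
  place<n (inj₂ j)             = <-trans (rest<y j) (toℕ<n y)

  place-injective : ∀ s t → place s ≡ place t → s ≡ t
  place-injective (inj₁ zero)          (inj₁ zero)          _ = refl
  place-injective (inj₁ zero)          (inj₁ (suc zero))    e = contradiction e x≢y′
  place-injective (inj₁ zero)          (inj₁ (suc (suc j))) e = contradiction e (>⇒≢ (low<x j))
  place-injective (inj₁ zero)          (inj₂ j)             e = contradiction (≡-sym e) (skip-≢ _ _)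
  place-injective (inj₁ (suc zero))    (inj₁ zero)          e = contradiction (≡-sym e) x≢y′
  place-injective (inj₁ (suc zero))    (inj₁ (suc zero))    _ = refl
  place-injective (inj₁ (suc zero))    (inj₁ (suc (suc j))) e = contradiction e (>⇒≢ (low<y j))
  place-injective (inj₁ (suc zero))    (inj₂ j)             e = contradiction e (>⇒≢ (rest<y j))
  place-injective (inj₁ (suc (suc j))) (inj₁ zero)          e = contradiction e (<⇒≢ (low<x j))
  place-injective (inj₁ (suc (suc j))) (inj₁ (suc zero))    e = contradiction e (<⇒≢ (low<y j))
  place-injective (inj₁ (suc (suc j))) (inj₁ (suc (suc i))) e = cong (λ i → inj₁ (suc (suc i))) (toℕ-injective e)
  place-injective (inj₁ (suc (suc j))) (inj₂ i)             e = contradiction e (<⇒≢ (low<rest j i))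
  place-injective (inj₂ j)             (inj₁ zero)          e = contradiction e (skip-≢ _ _)
  place-injective (inj₂ j)             (inj₁ (suc zero))    e = contradiction e (<⇒≢ (rest<y j))
  place-injective (inj₂ j)             (inj₁ (suc (suc i))) e = contradiction e (>⇒≢ (low<rest i j))
  place-injective (inj₂ j)             (inj₂ i)             e =
    cong inj₂ (toℕ-injective (+-cancelˡ-≡ c _ _ (skip-injective (toℕ x) e)))

  embed : Fin (sum ps) → Fin n
  embed a = fromℕ< (place<n (splitAt (suc (suc c)) a))

  toℕ-embed : ∀ a {s} → splitAt (suc (suc c)) a ≡ s → toℕ (embed a) ≡ place s
  toℕ-embed a refl = toℕ-fromℕ< (place<n (splitAt (suc (suc c)) a))

  embed-injective : Injective _≡_ _≡_ embed
  embed-injective {a} {b} e = begin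
    a                                            ≡⟨ join-splitAt (suc (suc c)) M a ⟨
    join (suc (suc c)) M (splitAt (suc (suc c)) a) ≡⟨ cong (join (suc (suc c)) M) sameSplit ⟩
    join (suc (suc c)) M (splitAt (suc (suc c)) b) ≡⟨ join-splitAt (suc (suc c)) M b ⟩
    b                                            ∎
    where
    open ≡-Reasoning
    sameSplit : splitAt (suc (suc c)) a ≡ splitAt (suc (suc c)) b
    sameSplit = place-injective _ _
      (trans (≡-sym (toℕ-embed a refl)) (trans (cong toℕ e) (toℕ-embed b refl)))

  module _ (a : Fin (sum ps)) where

    embed<c : ∀ {j} → splitAt (suc (suc c)) a ≡ inj₁ (suc (suc j)) → toℕ (embed a) < c
    embed<c {j} sa = subst (_< c) (≡-sym (toℕ-embed a sa)) (toℕ<n j)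

    embed<k : ∀ {j} → splitAt (suc (suc c)) a ≡ inj₂ j → toℕ (embed a) < k
    embed<k {j} sa = subst (_< k) (≡-sym (toℕ-embed a sa)) (rest<k j)

    embed≡x : splitAt (suc (suc c)) a ≡ inj₁ zero → embed a ≡ x
    embed≡x sa = toℕ-injective (toℕ-embed a sa)

    embed≡y : splitAt (suc (suc c)) a ≡ inj₁ (suc zero) → embed a ≡ y
    embed≡y sa = toℕ-injective (toℕ-embed a sa)

  embed-hom : ∀ a b → adj H a b ≡ true → adj (addEdge G x y x≢y) (embed a) (embed b) ≡ true
  embed-hom a b ab = edge (splitAt (suc (suc c)) a) (splitAt (suc (suc c)) b) refl refl
    where
    sameComp : comp ps a ≡ comp ps b
    sameComp = cliqueUnion-adj⇒sameComp ps {a} {b} ab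
    a≢b : a ≢ b
    a≢b = adj⇒≢ H {a} {b} ab
    fa≢fb : embed a ≢ embed b
    fa≢fb = a≢b ∘ embed-injective
    inG : adj G (embed a) (embed b) ≡ true → adj (addEdge G x y x≢y) (embed a) (embed b) ≡ true
    inG = addEdge-⊇ G x≢y {embed a} {embed b}
    G+xy : Fin n → Fin n → Set
    G+xy u v = adj (addEdge G x y x≢y) u v ≡ true
    edge : ∀ s t → splitAt (suc (suc c)) a ≡ s → splitAt (suc (suc c)) b ≡ t → G+xy (embed a) (embed b)
    edge (inj₁ _) (inj₂ _) sa sb
      with () ← trans (≡-sym (comp-inj₁ _ qs {a} sa)) (trans sameComp (comp-inj₂ _ qs {b} sb))
    edge (inj₂ _) (inj₁ _) sa sb
      with () ← trans (≡-sym (comp-inj₁ _ qs {b} sb)) (trans (≡-sym sameComp) (comp-inj₂ _ qs {a} sa))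
    edge (inj₁ (suc (suc _))) _ sa _ = inG (universal-adj c k fa≢fb (embed<c a sa))
    edge _ (inj₁ (suc (suc _))) _ sb =
      inG (trans (Graph.sym G (embed a) (embed b)) (universal-adj c k (fa≢fb ∘ ≡-sym) (embed<c b sb)))
    edge (inj₂ _) (inj₂ _) sa sb = inG (clique-adj c k fa≢fb (embed<k a sa) (embed<k b sb))
    edge (inj₁ zero) (inj₁ zero) sa sb =
      contradiction (trans (≡-sym (splitAt⁻¹-↑ˡ sa)) (splitAt⁻¹-↑ˡ sb)) a≢b
    edge (inj₁ (suc zero)) (inj₁ (suc zero)) sa sb =
      contradiction (trans (≡-sym (splitAt⁻¹-↑ˡ sa)) (splitAt⁻¹-↑ˡ sb)) a≢b
    edge (inj₁ zero) (inj₁ (suc zero)) sa sb =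
      subst₂ G+xy (≡-sym (embed≡x a sa)) (≡-sym (embed≡y b sb)) (addEdge-xy G x≢y)
    edge (inj₁ (suc zero)) (inj₁ zero) sa sb =
      subst₂ G+xy (≡-sym (embed≡y a sa)) (≡-sym (embed≡x b sb)) (addEdge-yx G x≢y)

  contains : Contains H (addEdge G x y x≢y)
  contains = embed , embed-injective , embed-hom

universalClique-saturated : ∀ c qs n → All (suc (suc c) ≤_) qs →
  Saturated (cliqueUnion (suc (suc c) ∷ qs)) (universalClique c (suc (c + sum qs)) n)
universalClique-saturated c qs n p≤qs = free , saturate
  where
  ps : List ℕ
  ps = suc (suc c) ∷ qs
  k : ℕ
  k = suc (c + sum qs)
  H : Graph (sum ps)
  H = cliqueUnion ps
  G : Graph n
  G = universalClique c k n
  dense : ∀ a → c < ∣ adj H a ∣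
  dense a = s≤s⁻¹ (subst (suc (suc c) ≤_) (≡-sym (suc-degree≡cliqueSize ps a))
                         (cliqueSize-≥ ps (≤-refl ∷ p≤qs) a))
  free : HFree H G
  free = universalClique-free c k H (≤-trans (m≤m+n c (sum qs)) (n≤1+n _)) dense ≤-refl
  saturate : ∀ x y (x≢y : x ≢ y) → adj G x y ≡ false → Contains H (addEdge G x y x≢y)
  saturate x y x≢y xy with nonEdge⇒far c k x≢y xy
  ... | c≤x , c≤y , inj₂ k≤y = Embedding.contains c qs x≢y c≤x k≤y
  ... | c≤x , c≤y , inj₁ k≤x with Embedding.contains c qs (x≢y ∘ ≡-sym) c≤y k≤x
  ...   | f , f-inj , hom =
    f , f-inj , λ a b ab → trans (≡-sym (addEdge-comm G x≢y (f a) (f b))) (hom a b ab)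

doubled-upper : ∀ {e} c n A B → e ≤ c * n + A → 2 * e ≤ (2 * c + 1 ∸ 1) * n + 2 * (A + B)
doubled-upper {e} c n A B e≤ = begin
  2 * e                        ≤⟨ *-monoʳ-≤ 2 (≤-trans e≤ (+-monoʳ-≤ (c * n) (m≤m+n A B))) ⟩
  2 * (c * n + (A + B))        ≡⟨ *-distribˡ-+ 2 (c * n) (A + B) ⟩
  2 * (c * n) + 2 * (A + B)    ≡⟨ cong (_+ 2 * (A + B)) (trans (cong (_* n) (m+n∸n≡m (2 * c) 1)) (*-assoc 2 c n)) ⟨
  (2 * c + 1 ∸ 1) * n + 2 * (A + B) ∎
  where open ≤-Reasoning

doubled-lower : ∀ {e} c n A B → c * n ≤ e + B → (2 * c + 1 ∸ 1) * n ≤ 2 * e + 2 * (A + B)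
doubled-lower {e} c n A B ≤e = begin
  (2 * c + 1 ∸ 1) * n          ≡⟨ trans (cong (_* n) (m+n∸n≡m (2 * c) 1)) (*-assoc 2 c n) ⟩
  2 * (c * n)                  ≤⟨ *-monoʳ-≤ 2 (≤-trans ≤e (+-monoʳ-≤ e (m≤n+m B A))) ⟩
  2 * (e + (A + B))            ≡⟨ *-distribˡ-+ 2 e (A + B) ⟩
  2 * e + 2 * (A + B)          ∎
  where open ≤-Reasoning

proposition10 : (p₁ : ℕ) (rest : List ℕ) →
    All (2 ≤_) (p₁ ∷ rest) → Linked _≤_ (p₁ ∷ rest) →
    StronglySatSharp (cliqueUnion (p₁ ∷ rest))
    × (Σ ℕ λ c → Σ ℕ λ c′ → ∀ (n : ℕ) → sum (p₁ ∷ rest) ≤ n →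
        (Σ (Graph n) λ G → Saturated (cliqueUnion (p₁ ∷ rest)) G
            × numEdges G ≤ (p₁ ∸ 2) * n + c)
        × (∀ (G : Graph n) → Saturated (cliqueUnion (p₁ ∷ rest)) G
            → (p₁ ∸ 2) * n ≤ numEdges G + c′))
proposition10 zero          rest (() ∷ _) _
proposition10 (suc zero)    rest (s≤s () ∷ _) _
proposition10 (suc (suc c)) rest _ sorted =
  (2 * c + 1 , cliqueUnion-wt c rest p≤rest , 2 * (k * k + c * (2 * c)) , sum ps , λ n _ →
     (universalClique c k n , saturated n , doubled-upper c n (k * k) (c * (2 * c)) (upper n)) ,
     (λ G sat → doubled-lower c n (k * k) (c * (2 * c)) (lower G sat))) ,
  (k * k , c * (2 * c) , λ n _ → (universalClique c k n , saturated n , upper n) , lower)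
  where
  ps : List ℕ
  ps = suc (suc c) ∷ rest
  k : ℕ
  k = suc (c + sum rest)
  p≤ps : All (suc (suc c) ≤_) ps
  p≤ps = Linked⇒All ≤-trans ≤-refl sorted
  p≤rest : All (suc (suc c) ≤_) rest
  p≤rest with _ ∷ p≤rest ← p≤ps = p≤rest
  saturated : ∀ n → Saturated (cliqueUnion ps) (universalClique c k n)
  saturated n = universalClique-saturated c rest n p≤rest
  upper : ∀ n → numEdges (universalClique c k n) ≤ c * n + k * k
  upper = numEdges-universalClique c k
  lower : ∀ {n} (G : Graph n) → Saturated (cliqueUnion ps) G → c * n ≤ numEdges G + c * (2 * c)
  lower G sat = edges-lower-bound G c
    (saturated⇒nonEdgesHaveCommonNeighbours {H = cliqueUnion ps} {G = G}
      (cliqueUnion-edgesHaveCommonNeighbours ps p≤ps) sat)
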